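{- Let $G$ be a finite simple graph of order $p$ with no isolated vertices and $p-2\ge \delta(G)\ge 1$. If there is a $\delta$-sequence $\{\mathcal G_i\}_{i=1}^s$ of $G$ such that $$\widetilde z_i(G)=\sum_{j=2}^{i}\widetilde y_j(G)\ge 0\quad\text{for all } 2\le i\le s,$$ then $str(G)=p+\delta(G)$.
   Context: For a graph $G$ of order $p$, a numbering is a bijection $f:V(G)\to\{1,\dots,p\}$; $str_f(G)=\max\{f(u)+f(v): uv\in E(G)\}$ and $str(G)=\min\{str_f(G): f \text{ a numbering of } G\}$. $\delta(\cdot)$ denotes minimum degree; $H_1+H_2$ denotes the disjoint union of graphs, $mK_1$ denotes $m$ isolated vertices, $K_r$ the complete graph. A sum with no terms is $0$. $\delta$-sequence: Let $G$ have no isolated vertices and $p-2\ge\delta(G)\ge1$. Set $\mathcal G_1=G_1=G$, $m_1=0$, $\delta_1=\delta(G)$. For $i\ge1$, if $\mathcal G_i$ is neither of the form $mK_1$ ($m\ge1$) nor $mK_1+K_r$ ($m\ge0$, $r\ge2$), write $\mathcal G_i=m_iK_1+G_i$, where $m_i\ge0$ is the number of isolated vertices of $\mathcal G_i$ and $G_i$ has no isolated vertices, and let $\delta_i=\delta(G_i)\ge1$; choose a vertex $u_i$ of degree $\delta_i$ in $G_i$ and let $\mathcal G_{i+1}$ be obtained from $\mathcal G_i$ by deleting its $m_i$ isolated vertices, the vertex $u_i$, and all neighbors of $u_i$. Stop at the first index $s$ for which $\mathcal G_s=m_sK_1$ with $m_s\ge1$ (then set $\delta_s=0$) or $\mathcal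 G_s=m_sK_1+K_r$ with $m_s\ge0$, $r\ge2$ (then $G_s=K_r$ and $\delta_s=r-1$). The sequence $\{\mathcal G_i\}_{i=1}^s$ is a $\delta$-sequence of $G$, and $\widetilde y_j(G)=m_j+1-\delta_j$ for $1\le j\le s$. -}

module Defs where

open import Data.Nat using (ℕ; zero; suc; _+_; _∸_; _≤_; _⊔_; _⊓_)
open import Data.Bool using (Bool; true; false; if_then_else_; _∧_; not)
open import Data.Fin using (Fin; toℕ; _≟_)
open import Data.Fin.Permutation using (Permutation′; _⟨$⟩ʳ_)
open import Data.List using (List; []; _∷_; foldr)
open import Data.List.Base using (allFin)
open import Data.Integer using (ℤ; +_; _-_) renaming (_+_ to _+ℤ_; _≤_ to _≤ℤ_)
open import Data.Product using (Σ; _×_; ∃)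
open import Data.Unit using (⊤)
open import Relation.Nullary using (¬_; does)
open import Relation.Binary.PropositionalEquality using (_≡_)

record Graph (p : ℕ) : Set where
  field
    adj    : Fin p → Fin p → Bool
    sym    : ∀ u v → adj u v ≡ adj v u
    irrefl : ∀ v → adj v v ≡ false
open Graph public

-- Vertex subsets (used to describe the induced subgraphs 𝒢_i).
VSet : ℕ → Set
VSet p = Fin p → Bool

full : ∀ {p} → VSet p
full _ = true

count : ∀ {p} → (Fin p → Bool) → ℕ
count {p} P = foldr (λ v acc → (if P v then 1 else 0) + acc) 0 (allFin p)

module _ {p : ℕ} (G : Graph p) where

  deg : VSet p → Fin p → ℕ
  deg S v = count (λ w → S w ∧ adj G v w)

  isIsolated : VSet p → Fin p → Bool
  isIsolated S v = S v ∧ (deg S v Data.Nat.≡ᵇ 0)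

  -- vertices of S that are not isolated in 𝒢[S]; this is the vertex set of G_i
  core : VSet p → VSet p
  core S v = S v ∧ not (isIsolated S v)

  mIso : VSet p → ℕ
  mIso S = count (isIsolated S)

  rCore : VSet p → ℕ
  rCore S = count (core S)

  -- minimum degree of the graph with vertex set core S (= G_i);
  -- degrees in G_i equal degrees in 𝒢[S] since isolated vertices have no neighbours.
  -- (start value p exceeds every degree, so this is the true minimum when core S ≠ ∅)
  minDeg : VSet p → ℕ
  minDeg S = foldr (λ v acc → if core S v then deg S v ⊓ acc else acc) p (allFin p)

  δ : ℕ
  δ = minDeg full

  -- 𝒢[S] = m K_1 with m ≥ 1
  FormIso : VSet p → Set
  FormIso S = (∀ v → core S v ≡ false) × (1 ≤ mIso S)

  -- 𝒢[S] = m K_1 + K_r with m ≥ 0, r ≥ 2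
  FormClique : VSet p → Set
  FormClique S = (∀ u v → core S u ≡ true → core S v ≡ true → ¬ (u ≡ v) → adj G u v ≡ true)
               × (2 ≤ rCore S)

  next : VSet p → Fin p → VSet p
  next S u v = core S v ∧ not (does (u ≟ v)) ∧ not (adj G u v)

  ytil : ℕ → ℕ → ℤ
  ytil m d = (+ m +ℤ + 1) - + d

  -- DSeq S ys : there is a δ-sequence continuation starting with 𝒢_i = 𝒢[S],
  -- whose values ỹ_i, ỹ_{i+1}, …, ỹ_s are the list ys.
  data DSeq : VSet p → List ℤ → Set where
    stopIso    : ∀ {S} → FormIso S → DSeq S (ytil (mIso S) 0 ∷ [])
    stopClique : ∀ {S} → FormClique S → DSeq S (ytil (mIso S) (rCore S ∸ 1) ∷ [])
    step       : ∀ {S ys} (u : Fin p) →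
                 ¬ FormIso S → ¬ FormClique S →
                 core S u ≡ true → deg S u ≡ minDeg S →
                 DSeq (next S u) ys →
                 DSeq S (ytil (mIso S) (minDeg S) ∷ ys)

  -- numbering f (a bijection V → {1..p}, label = toℕ (π v) + 1) and str_f(G)
  label : Permutation′ p → Fin p → ℕ
  label π v = suc (toℕ (π ⟨$⟩ʳ v))

  strf : Permutation′ p → ℕ
  strf π = foldr (λ u acc → foldr (λ v acc′ →
              (if adj G u v then label π u + label π v else 0) ⊔ acc′) acc (allFin p))
              0 (allFin p)

  IsStr : ℕ → Set
  IsStr n = (Σ (Permutation′ p) λ π → strf π ≡ n) × (∀ π → n ≤ strf π)

PrefNonneg : ℤ → List ℤ → Set
PrefNonneg acc [] = ⊤
PrefNonneg acc (y ∷ ys) = (+ 0 ≤ℤ acc +ℤ y) × PrefNonneg (acc +ℤ y) ys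

-- z̃_i = Σ_{j=2}^i ỹ_j ≥ 0 for 2 ≤ i ≤ s, given ys = ỹ_1 … ỹ_s
ZNonneg : List ℤ → Set
ZNonneg [] = ⊤
ZNonneg (_ ∷ ys) = PrefNonneg (+ 0) ys

-- Lower bound: the vertex numbered p has at least δ neighbours; their numbers are distinct
-- and below p, so one of them is at least δ.
-- Upper bound: number the vertices along the δ-sequence.  At step i, when 𝒢_i is to receive
-- the interval of numbers following a, the neighbours of u_i get the first δ_i of them,
-- 𝒢_{i+1} the next ones (recursively), and u_i and the m_i isolated vertices of 𝒢_i the last
-- ones.  An edge of 𝒢_i not inside 𝒢_{i+1} joins a neighbour of u_i to another one or to u_i,
-- and counting interval lengths bounds its number sum by p + δ − z̃_i (with z̃_1 = 0); an edge
-- leaving 𝒢_i ends in an earlier neighbourhood, which has smaller numbers.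

module Submission where

open import Axiom.UniquenessOfIdentityProofs using (module Decidable⇒UIP)
open import Data.Bool using (true; false; _∧_; not; if_then_else_)
open import Data.Bool.Properties using (T-≡; ¬-not; ∧-zeroʳ)
open import Data.Empty using (⊥; ⊥-elim)
open import Data.Fin using (Fin; zero; suc; toℕ; fromℕ<; cast; _≟_)
open import Data.Fin.Permutation using (Permutation′; _⟨$⟩ʳ_; _⟨$⟩ˡ_; permutation; inverseˡ; inverseʳ)
open import Data.Fin.Properties
  using (toℕ-cast; cast-involutive; toℕ-fromℕ<; fromℕ<-injective; toℕ-injective; pigeonhole)
  renaming (<⇒≢ to <⇒≢ᶠ)
open import Data.Integer using (ℤ; +_; _-_; +≤+) renaming (_+_ to _+ℤ_; _≤_ to _≤ℤ_)
import Data.Integer.Properties as ℤ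
open import Data.Integer.Tactic.RingSolver using (solve-∀)
open import Data.List using (List; []; _∷_; _++_; length; foldr; lookup; filterᵇ; allFin)
open import Data.List.Membership.Propositional using (_∈_; find)
open import Data.List.Membership.Propositional.Properties using (∈-filter⁺; ∈-filter⁻; ∈-allFin; ∈-lookup; ∈-++⁺ʳ; ∈-length)
open import Data.List.Membership.Setoid.Properties using (unique⇒irrelevant)
open import Data.List.Properties using (length-++; length-tabulate; length-filter; filter-all; ++-assoc; ++-identityʳ)
open import Data.List.Relation.Binary.Permutation.Propositional
  using (_↭_; ↭-refl; ↭-sym; ↭-trans; prep; ↭⇒↭ₛ; module PermutationReasoning)
open import Data.List.Relation.Binary.Permutation.Propositional.Properties using (shift; ↭-length; ∈-resp-↭; ++⁺ˡ; ++⁺ʳ)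
open import Data.List.Relation.Binary.Permutation.Setoid.Properties using (Unique-resp-↭)
open import Data.List.Relation.Unary.All using (All; all?; universal; _∷_) renaming (lookup to All-lookup)
open import Data.List.Relation.Unary.All.Properties using (All¬⇒¬Any; ¬All⇒Any¬)
open import Data.List.Relation.Unary.AllPairs using (_∷_)
open import Data.List.Relation.Unary.Any using (here; there; index)
open import Data.List.Relation.Unary.Any.Properties using (lookup-index)
open import Data.List.Relation.Unary.Unique.Propositional using (Unique)
import Data.List.Relation.Unary.Unique.Propositional.Properties as Unique
open import Data.Nat using (ℕ; suc; _+_; _∸_; _⊔_; _⊓_; _≤_; _<_; _<?_; z≤n; s≤s)
open import Data.Nat.Properties
  using ( ≤-refl; ≤-trans; ≤-reflexive; ≤-antisym; <-≤-trans; ≤-<-trans; <-cmp; ≮⇒≥; <⇒≱; m<1+n⇒m≤n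
        ; m≤m+n; m≤n+m; +-mono-≤; +-monoʳ-≤; +-monoˡ-≤; +-mono-<-≤; +-mono-≤-<; +-cancelʳ-≤
        ; +-assoc; +-comm; +-suc; suc-injective; m+[n∸m]≡n; m∸n≤m; ∸-monoˡ-≤; ∸-monoˡ-<
        ; ⊔-lub; m≤m⊔n; m≤n⊔m; ⊓-glb; m⊓n≤m; m⊓n≤n; ≡ᵇ⇒≡; module ≤-Reasoning )
open import Data.Nat.Tactic.RingSolver using () renaming (solve-∀ to solve-ℕ)
open import Data.Product using (_×_; _,_; proj₁; proj₂; Σ)
open import Data.Sum using (_⊎_; inj₁; inj₂)
open import Data.Unit using (tt)
open import Defs hiding (sym)
open import Function using (_∘_; id; Equivalence)
open import Relation.Binary.PropositionalEquality
  using (_≡_; _≢_; refl; sym; trans; cong; cong₂; subst; subst₂; setoid; module ≡-Reasoning)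
open import Relation.Nullary using (¬_; Dec; does; yes; no; contradiction)
open import Relation.Nullary.Decidable using (T?; dec-true)
open import Relation.Binary.Definitions using (tri<; tri≈; tri>)

-- Arithmetic

slack : ℕ → ℕ → ℤ
slack N c = + N - + c

slack+ỹ : ∀ N c m d → slack N c +ℤ ((+ m +ℤ + 1) - + d) ≡ + (N + (m + 1)) - + (c + d)
slack+ỹ N c m d = ring (+ N) (+ c) (+ m) (+ d)
  where
  ring : ∀ N c m d → (N - c) +ℤ ((m +ℤ + 1) - d) ≡ (N +ℤ (m +ℤ + 1)) - (c +ℤ d)
  ring = solve-∀

0≤slack+ỹ⇒ : ∀ N c m d → + 0 ≤ℤ slack N c +ℤ ((+ m +ℤ + 1) - + d) → c + d ≤ N + (m + 1)
0≤slack+ỹ⇒ N c m d h = ℤ.drop‿+≤+ (ℤ.0≤i-j⇒j≤i (subst (+ 0 ≤ℤ_) (slack+ỹ N c m d) h))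

0≤slack+ỹ⇐ : ∀ N c m d → c + d ≤ N + (m + 1) → + 0 ≤ℤ slack N c +ℤ ((+ m +ℤ + 1) - + d)
0≤slack+ỹ⇐ N c m d h = subst (+ 0 ≤ℤ_) (sym (slack+ỹ N c m d)) (ℤ.i≤j⇒0≤j-i (+≤+ h))

slack+ỹ≤slack : ∀ N c c′ m d → c′ + (m + 1) ≤ c + d →
                slack N c +ℤ ((+ m +ℤ + 1) - + d) ≤ℤ slack N c′
slack+ỹ≤slack N c c′ m d h = begin
  slack N c +ℤ ((+ m +ℤ + 1) - + d)  ≡⟨ slack+ỹ N c m d ⟩
  + (N + (m + 1)) - + (c + d)         ≤⟨ ℤ.+-monoʳ-≤ (+ (N + (m + 1))) (ℤ.neg-mono-≤ (+≤+ h)) ⟩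
  + (N + (m + 1)) - + (c′ + (m + 1))  ≡⟨ cancel (+ N) (+ c′) (+ (m + 1)) ⟩
  slack N c′                          ∎
  where
  open ℤ.≤-Reasoning
  cancel : ∀ N c k → (N +ℤ k) - (c +ℤ k) ≡ N - c
  cancel = solve-∀

PrefNonneg-mono : ∀ {a b} ys → a ≤ℤ b → PrefNonneg a ys → PrefNonneg b ys
PrefNonneg-mono []       _   _            = tt
PrefNonneg-mono (y ∷ ys) a≤b (0≤a+y , nn) =
  ℤ.≤-trans 0≤a+y a+y≤b+y , PrefNonneg-mono ys a+y≤b+y nn
  where a+y≤b+y = ℤ.+-monoˡ-≤ y a≤b

n∸1<n : ∀ {n} → 1 ≤ n → n ∸ 1 < n
n∸1<n 1≤n = ≤-reflexive (m+[n∸m]≡n 1≤n)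

distinct-sum< : ∀ {x y K} → x ≤ K → y ≤ K → x ≢ y → x + y < K + K
distinct-sum< {x} {y} x≤K y≤K x≢y with <-cmp x y
... | tri< x<y _ _ = +-mono-<-≤ (<-≤-trans x<y y≤K) y≤K
... | tri≈ _ x≡y _ = contradiction x≡y x≢y
... | tri> _ _ y<x = +-mono-≤-< x≤K (<-≤-trans y<x x≤K)

step-identity : ∀ a n o k m → a + n + (a + n + o + k) + (m + 1) ≡ a + a + (n + (o + (k + m))) + 1 + n
step-identity = solve-ℕ

a+a+o≤a+[a+o+k] : ∀ a o k → a + a + o ≤ a + (a + o + k)
a+a+o≤a+[a+o+k] a o k = begin
  a + a + o        ≡⟨ +-assoc a a o ⟩
  a + (a + o)      ≤⟨ +-monoʳ-≤ a (m≤m+n (a + o) k) ⟩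
  a + (a + o + k)  ∎
  where open ≤-Reasoning

a+a+o+1≤a+[a+o+k] : ∀ a o k → 1 ≤ k → a + a + o + 1 ≤ a + (a + o + k)
a+a+o+1≤a+[a+o+k] a o k 1≤k = begin
  a + a + o + 1    ≡⟨ reassoc a o ⟩
  a + (a + o + 1)  ≤⟨ +-monoʳ-≤ a (+-monoʳ-≤ (a + o) 1≤k) ⟩
  a + (a + o + k)  ∎
  where
  open ≤-Reasoning
  reassoc : ∀ a o → a + a + o + 1 ≡ a + (a + o + 1)
  reassoc = solve-ℕ

clique-room : ∀ a r m N → 1 ≤ r → a + a + (r + m) + 1 + (r ∸ 1) ≤ N + (m + 1) → (a + r) + (a + r) ≤ suc N
clique-room a (suc r) m N _ h = +-cancelʳ-≤ m _ _ (subst₂ _≤_ (lhs a r m) (rhs N m) h)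
  where
  lhs : ∀ a r m → a + a + (suc r + m) + 1 + r ≡ a + suc r + (a + suc r) + m
  lhs = solve-ℕ
  rhs : ∀ N m → N + (m + 1) ≡ suc N + m
  rhs = solve-ℕ

∧-true⁻ : ∀ {a b} → a ∧ b ≡ true → a ≡ true × b ≡ true
∧-true⁻ {true} {true} refl = refl , refl

∧-not-true⁻ : ∀ {a b} → a ∧ not b ≡ true → a ≡ true × b ≡ false
∧-not-true⁻ {true} {false} refl = refl , refl

∧-not-true⁺ : ∀ {a b} → a ≡ true → b ≡ false → a ∧ not b ≡ true
∧-not-true⁺ refl refl = refl

∧-false : ∀ a {b} → b ≡ false → a ∧ b ≡ false
∧-false a refl = ∧-zeroʳ a

-- Maxima over a table

module _ {A : Set} (g : A → A → ℕ) where

  row : A → ℕ → List A → ℕ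
  row u acc = foldr (λ v acc′ → g u v ⊔ acc′) acc

  table : List A → List A → ℕ
  table us vs = foldr (λ u acc → row u acc vs) 0 us

  row-lub : ∀ {N u acc} vs → (∀ v → g u v ≤ N) → acc ≤ N → row u acc vs ≤ N
  row-lub []       _   acc≤N = acc≤N
  row-lub (v ∷ vs) g≤N acc≤N = ⊔-lub (g≤N v) (row-lub vs g≤N acc≤N)

  acc≤row : ∀ {u} acc vs → acc ≤ row u acc vs
  acc≤row acc []       = ≤-refl
  acc≤row acc (v ∷ vs) = ≤-trans (acc≤row acc vs) (m≤n⊔m _ _)

  entry≤row : ∀ {u v} acc {vs} → v ∈ vs → g u v ≤ row u acc vs
  entry≤row acc (here refl)        = m≤m⊔n _ _
  entry≤row acc {_ ∷ vs} (there v∈) = ≤-trans (entry≤row acc v∈) (m≤n⊔m _ _)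

  table-lub : ∀ {N} us vs → (∀ u v → g u v ≤ N) → table us vs ≤ N
  table-lub []       vs g≤N = z≤n
  table-lub (u ∷ us) vs g≤N = row-lub vs (g≤N u) (table-lub us vs g≤N)

  entry≤table : ∀ {u v us vs} → u ∈ us → v ∈ vs → g u v ≤ table us vs
  entry≤table {us = _ ∷ us} (here refl) v∈ = entry≤row _ v∈
  entry≤table {us = u ∷ us} {vs} (there u∈) v∈ = ≤-trans (entry≤table u∈ v∈) (acc≤row _ vs)

-- Vertex lists

module _ {p : ℕ} where

  vertices : VSet p → List (Fin p)
  vertices P = filterᵇ P (allFin p)

  _⊆_ : VSet p → VSet p → Set
  P ⊆ Q = ∀ {v} → P v ≡ true → Q v ≡ true

  _∖_ : VSet p → VSet p → VSet p
  (S ∖ Q) v = S v ∧ not (Q v)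

  ⁅_⁆ : Fin p → VSet p
  ⁅ u ⁆ v = does (u ≟ v)

  ⁅⁆-refl : ∀ u → ⁅ u ⁆ u ≡ true
  ⁅⁆-refl u = dec-true (u ≟ u) refl

  ⁅⁆-sound : ∀ {u v} → ⁅ u ⁆ v ≡ true → u ≡ v
  ⁅⁆-sound {u} {v} u∈ with u ≟ v
  ... | yes u≡v = u≡v
  ... | no  _   = contradiction u∈ λ ()

  count≡length-vertices : ∀ P → count P ≡ length (vertices P)
  count≡length-vertices P = go (allFin p)
    where
    go : ∀ xs → foldr (λ v acc → (if P v then 1 else 0) + acc) 0 xs ≡ length (filterᵇ P xs)
    go []       = refl
    go (x ∷ xs) with P x
    ... | true  = cong suc (go xs)
    ... | false = go xs

  ∈-vertices⁺ : ∀ {P v} → P v ≡ true → v ∈ vertices P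
  ∈-vertices⁺ {P} {v} Pv = ∈-filter⁺ (T? ∘ P) (∈-allFin v) (Equivalence.from T-≡ Pv)

  ∈-vertices⁻ : ∀ {P v} → v ∈ vertices P → P v ≡ true
  ∈-vertices⁻ {P} v∈ = Equivalence.to T-≡ (proj₂ (∈-filter⁻ (T? ∘ P) {xs = allFin p} v∈))

  vertices-unique : ∀ P → Unique (vertices P)
  vertices-unique P = Unique.filter⁺ (T? ∘ P) (Unique.allFin⁺ p)

  vertices-split : ∀ {S Q} → Q ⊆ S → vertices S ↭ vertices Q ++ vertices (S ∖ Q)
  vertices-split {S} {Q} Q⊆S = go (allFin p)
    where
    go : ∀ xs → filterᵇ S xs ↭ filterᵇ Q xs ++ filterᵇ (S ∖ Q) xs
    go []       = ↭-refl
    go (x ∷ xs) with S x in Sx | Q x in Qx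
    ... | true  | true  = prep x (go xs)
    ... | true  | false = ↭-trans (prep x (go xs)) (↭-sym (shift x (filterᵇ Q xs) _))
    ... | false | false = go xs
    ... | false | true  = contradiction (trans (sym Sx) (Q⊆S Qx)) λ ()

  vertices-full : vertices full ≡ allFin p
  vertices-full = filter-all (T? ∘ full) (universal _ (allFin p))

  vertices-cong : ∀ {P Q} → P ⊆ Q → Q ⊆ P → vertices P ≡ vertices Q
  vertices-cong {P} {Q} P⊆Q Q⊆P = go (allFin p)
    where
    go : ∀ xs → filterᵇ P xs ≡ filterᵇ Q xs
    go []       = refl
    go (x ∷ xs) with P x in Px | Q x in Qx
    ... | true  | true  = cong (x ∷_) (go xs)
    ... | false | false = go xs
    ... | true  | false = contradiction (trans (sym Qx) (P⊆Q Px)) λ ()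
    ... | false | true  = contradiction (trans (sym Px) (Q⊆P Qx)) λ ()

  length-vertices-mono : ∀ {P Q} → P ⊆ Q → length (vertices P) ≤ length (vertices Q)
  length-vertices-mono {P} {Q} P⊆Q = begin
    length (vertices P)                               ≤⟨ m≤m+n _ _ ⟩
    length (vertices P) + length (vertices (Q ∖ P))   ≡⟨ length-++ (vertices P) ⟨
    length (vertices P ++ vertices (Q ∖ P))           ≡⟨ ↭-length (vertices-split P⊆Q) ⟨
    length (vertices Q)                               ∎
    where open ≤-Reasoning

  length-vertices-⁅⁆ : ∀ u → length (vertices ⁅ u ⁆) ≤ 1
  length-vertices-⁅⁆ u = go (vertices ⁅ u ⁆) (vertices-unique ⁅ u ⁆) (⁅⁆-sound ∘ ∈-vertices⁻)
    where
    go : ∀ xs → Unique xs → (∀ {v} → v ∈ xs → u ≡ v) → length xs ≤ 1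
    go []          _                   _  = z≤n
    go (_ ∷ [])    _                   _  = ≤-refl
    go (_ ∷ _ ∷ _) ((x≢y ∷ _) ∷ _) u≡ = contradiction (trans (sym (u≡ (here refl))) (u≡ (there (here refl)))) x≢y

-- Numberings from vertex lists

index-∈-lookup : ∀ {A : Set} {xs : List A} i → index (∈-lookup {xs = xs} i) ≡ i
index-∈-lookup {xs = _ ∷ _} zero    = refl
index-∈-lookup {xs = _ ∷ _} (suc i) = cong suc (index-∈-lookup i)

index-++ : ∀ {A : Set} {xs P Q : List A} {v} → Unique xs → xs ≡ P ++ Q →
           (v∈xs : v ∈ xs) → v ∈ P → toℕ (index v∈xs) < length P
index-++ uniq refl = go uniq
  where
  go : ∀ {P Q v} → Unique (P ++ Q) → (v∈ : v ∈ P ++ Q) → v ∈ P → toℕ (index v∈) < length P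
  go {_ ∷ _} _         (here _)   _           = s≤s z≤n
  go {_ ∷ _} (_ ∷ u)   (there v∈) (there v∈P) = s≤s (go u v∈ v∈P)
  go {_ ∷ _} (x∉ ∷ _) (there v∈) (here refl) = contradiction v∈ (All¬⇒¬Any x∉)

module _ {p : ℕ} {xs : List (Fin p)} (uniq : Unique xs) where

  index-≡ : ∀ {v w} (v∈ : v ∈ xs) (w∈ : w ∈ xs) → v ≡ w → index v∈ ≡ index w∈
  index-≡ v∈ w∈ refl = cong index (unique⇒irrelevant (setoid (Fin p)) (Decidable⇒UIP.≡-irrelevant _≟_) uniq v∈ w∈)

  lookup-injective : ∀ {i j} → lookup xs i ≡ lookup xs j → i ≡ j
  lookup-injective {i} {j} eq = begin
    i                             ≡⟨ index-∈-lookup i ⟨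
    index (∈-lookup {xs = xs} i)  ≡⟨ index-≡ (∈-lookup i) (∈-lookup j) eq ⟩
    index (∈-lookup {xs = xs} j)  ≡⟨ index-∈-lookup j ⟩
    j                             ∎
    where open ≡-Reasoning

⟨$⟩ʳ-injective : ∀ {p} (π : Permutation′ p) {v w} → π ⟨$⟩ʳ v ≡ π ⟨$⟩ʳ w → v ≡ w
⟨$⟩ʳ-injective π {v} {w} eq = begin
  v                    ≡⟨ inverseˡ π ⟨
  π ⟨$⟩ˡ (π ⟨$⟩ʳ v)    ≡⟨ cong (π ⟨$⟩ˡ_) eq ⟩
  π ⟨$⟩ˡ (π ⟨$⟩ʳ w)    ≡⟨ inverseˡ π ⟩
  w                    ∎
  where open ≡-Reasoning

module Numbering {p : ℕ} {L : List (Fin p)} (L↭ : L ↭ allFin p) where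

  complete : ∀ v → v ∈ L
  complete v = ∈-resp-↭ (↭-sym L↭) (∈-allFin v)

  unique : Unique L
  unique = Unique-resp-↭ (setoid (Fin p)) (↭⇒↭ₛ (↭-sym L↭)) (Unique.allFin⁺ p)

  length≡p : length L ≡ p
  length≡p = trans (↭-length L↭) (length-tabulate id)

  numbering : Permutation′ p
  numbering = permutation to from to∘from from∘to
    where
    to : Fin p → Fin p
    to v = cast length≡p (index (complete v))
    from : Fin p → Fin p
    from i = lookup L (cast (sym length≡p) i)
    to∘from : ∀ i → to (from i) ≡ i
    to∘from i = begin
      cast length≡p (index (complete (lookup L j)))
        ≡⟨ cong (cast length≡p) (index-≡ unique _ (∈-lookup {xs = L} j) refl) ⟩
      cast length≡p (index (∈-lookup {xs = L} j))
        ≡⟨ cong (cast length≡p) (index-∈-lookup {xs = L} j) ⟩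
      cast length≡p j
        ≡⟨ cast-involutive length≡p (sym length≡p) i ⟩
      i ∎
      where
      open ≡-Reasoning
      j = cast (sym length≡p) i
    from∘to : ∀ v → from (to v) ≡ v
    from∘to v = begin
      lookup L (cast (sym length≡p) (cast length≡p (index (complete v))))
        ≡⟨ cong (lookup L) (cast-involutive (sym length≡p) length≡p _) ⟩
      lookup L (index (complete v))
        ≡⟨ lookup-index (complete v) ⟨
      v ∎
      where open ≡-Reasoning

  numbering-prefix : ∀ {P Q v} → L ≡ P ++ Q → v ∈ P → suc (toℕ (numbering ⟨$⟩ʳ v)) ≤ length P
  numbering-prefix {v = v} L≡ v∈P rewrite toℕ-cast length≡p (index (complete v)) =
    index-++ unique L≡ (complete v) v∈P

-- Graphs and δ-sequences

module _ {p : ℕ} (G : Graph p) where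

  adj-sym : ∀ {x y} → adj G x y ≡ true → adj G y x ≡ true
  adj-sym {x} {y} xy = trans (Graph.sym G y x) xy

  adj⇒≢ : ∀ {x y} → adj G x y ≡ true → x ≢ y
  adj⇒≢ {x} xy refl = contradiction (trans (sym xy) (irrefl G x)) λ ()

  nbrs : VSet p → Fin p → VSet p
  nbrs S u v = S v ∧ adj G u v

  isolated⇒∈ : ∀ {S v} → isIsolated G S v ≡ true → S v ≡ true
  isolated⇒∈ = proj₁ ∘ ∧-true⁻

  core⇒∈ : ∀ {S v} → core G S v ≡ true → S v ≡ true
  core⇒∈ = proj₁ ∘ ∧-not-true⁻

  core⇒¬isolated : ∀ {S v} → core G S v ≡ true → isIsolated G S v ≡ false
  core⇒¬isolated = proj₂ ∘ ∧-not-true⁻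

  ¬isolated⇒core : ∀ {S v} → S v ≡ true → isIsolated G S v ≡ false → core G S v ≡ true
  ¬isolated⇒core = ∧-not-true⁺

  ¬core⇒isolated : ∀ {S v} → S v ≡ true → core G S v ≡ false → isIsolated G S v ≡ true
  ¬core⇒isolated {S} Sv ¬cv = ¬-not λ ¬iv → contradiction (trans (sym ¬cv) (¬isolated⇒core {S = S} Sv ¬iv)) λ ()

  isolated-no-edge : ∀ {S w x} → isIsolated G S w ≡ true → S x ≡ true → adj G w x ≡ true → ⊥
  isolated-no-edge {S} {w} {x} iso Sx wx =
    contradiction (subst (0 <_) (trans (sym (count≡length-vertices (nbrs S w))) deg≡0) 0<deg) λ ()
    where
    deg≡0 : deg G S w ≡ 0
    deg≡0 = ≡ᵇ⇒≡ _ 0 (Equivalence.from T-≡ (proj₂ (∧-true⁻ iso)))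
    0<deg : 0 < length (vertices (nbrs S w))
    0<deg = ∈-length (∈-vertices⁺ {P = nbrs S w} (cong₂ _∧_ Sx wx))

  minDeg≤deg : ∀ {S v} → core G S v ≡ true → minDeg G S ≤ deg G S v
  minDeg≤deg {S} {v} cv = go (allFin p) (∈-allFin v)
    where
    go : ∀ xs → v ∈ xs → foldr (λ w acc → if core G S w then deg G S w ⊓ acc else acc) p xs ≤ deg G S v
    go (_ ∷ _)  (here refl) rewrite cv = m⊓n≤m _ _
    go (x ∷ xs) (there v∈) with core G S x
    ... | true  = ≤-trans (m⊓n≤n _ _) (go xs v∈)
    ... | false = go xs v∈

  minDeg-glb : ∀ {S k} → k ≤ p → (∀ {v} → core G S v ≡ true → k ≤ deg G S v) → k ≤ minDeg G S
  minDeg-glb {S} {k} k≤p k≤deg = go (allFin p)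
    where
    go : ∀ xs → k ≤ foldr (λ w acc → if core G S w then deg G S w ⊓ acc else acc) p xs
    go []       = k≤p
    go (x ∷ xs) with core G S x in cx
    ... | true  = ⊓-glb (k≤deg cx) (go xs)
    ... | false = go xs

  clique-rCore∸1≤minDeg : ∀ {S} → FormClique G S → rCore G S ∸ 1 ≤ minDeg G S
  clique-rCore∸1≤minDeg {S} (clique , _) = minDeg-glb (≤-trans (m∸n≤m _ 1) rCore≤p) rCore∸1≤deg
    where
    rCore≤p : rCore G S ≤ p
    rCore≤p = begin
      rCore G S                          ≡⟨ count≡length-vertices (core G S) ⟩
      length (vertices (core G S))       ≤⟨ length-filter (T? ∘ core G S) (allFin p) ⟩
      length (allFin p)                  ≡⟨ length-tabulate id ⟩
      p                                  ∎
      where open ≤-Reasoning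
    rCore∸1≤deg : ∀ {v} → core G S v ≡ true → rCore G S ∸ 1 ≤ deg G S v
    rCore∸1≤deg {v} cv = ∸-monoˡ-≤ 1 (begin
      rCore G S                                                       ≡⟨ count≡length-vertices (core G S) ⟩
      length (vertices (core G S))                                    ≡⟨ ↭-length (vertices-split {S = core G S} v∈core) ⟩
      length (vertices ⁅ v ⁆ ++ vertices others)                      ≡⟨ length-++ (vertices ⁅ v ⁆) ⟩
      length (vertices ⁅ v ⁆) + length (vertices others)              ≤⟨ +-mono-≤ (length-vertices-⁅⁆ v) others≤ ⟩
      1 + length (vertices (nbrs S v))                                ≡⟨ cong suc (count≡length-vertices (nbrs S v)) ⟨
      suc (deg G S v)                                                 ∎)
      where
      open ≤-Reasoning
      others = core G S ∖ ⁅ v ⁆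
      v∈core : ⁅ v ⁆ ⊆ core G S
      v∈core v≡ = subst (λ w → core G S w ≡ true) (⁅⁆-sound v≡) cv
      others⊆nbrs : others ⊆ nbrs S v
      others⊆nbrs {w} h = cong₂ _∧_ (core⇒∈ {S = S} cw) (clique v w cv cw v≢w)
        where
        cw = proj₁ (∧-not-true⁻ {core G S w} h)
        v≢w : v ≢ w
        v≢w v≡w = contradiction (trans (sym (proj₂ (∧-not-true⁻ {core G S w} h))) (dec-true (v ≟ w) v≡w)) λ ()
      others≤ : length (vertices others) ≤ length (vertices (nbrs S v))
      others≤ = length-vertices-mono {P = others} {Q = nbrs S v} others⊆nbrs

  edge-sum : Permutation′ p → Fin p → Fin p → ℕ
  edge-sum π u v = if adj G u v then label G π u + label G π v else 0

  strf-lub : ∀ π {N} → (∀ {u v} → adj G u v ≡ true → label G π u + label G π v ≤ N) → strf G π ≤ N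
  strf-lub π {N} bound = table-lub (edge-sum π) (allFin p) (allFin p) sum≤N
    where
    sum≤N : ∀ u v → edge-sum π u v ≤ N
    sum≤N u v with adj G u v in uv
    ... | true  = bound uv
    ... | false = z≤n

  edge≤strf : ∀ π {u v} → adj G u v ≡ true → label G π u + label G π v ≤ strf G π
  edge≤strf π {u} {v} uv =
    subst (_≤ strf G π) edge-sum≡ (entry≤table (edge-sum π) (∈-allFin u) (∈-allFin v))
    where
    edge-sum≡ : edge-sum π u v ≡ label G π u + label G π v
    edge-sum≡ rewrite uv = refl

  labels<⇒length≤ : ∀ π {k xs} → Unique xs → All (λ v → label G π v < k) xs → length xs ≤ k ∸ 1
  labels<⇒length≤ π {k} {xs} uniq labels< = ≮⇒≥ collision
    where
    bound : ∀ i → toℕ (π ⟨$⟩ʳ lookup xs i) < k ∸ 1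
    bound i = ∸-monoˡ-< (All-lookup labels< (∈-lookup i)) (s≤s z≤n)
    f : Fin (length xs) → Fin (k ∸ 1)
    f i = fromℕ< (bound i)
    collision : ¬ (k ∸ 1 < length xs)
    collision long with pigeonhole long f
    ... | i , j , i<j , fi≡fj = <⇒≢ᶠ i<j (lookup-injective uniq
            (⟨$⟩ʳ-injective π (toℕ-injective (fromℕ<-injective _ _ (bound i) (bound j) fi≡fj))))

  p+δ≤strf : 1 ≤ p → (∀ v → 1 ≤ deg G full v) → ∀ π → p + δ G ≤ strf G π
  p+δ≤strf 1≤p no-isolated π = from-labels (all? (λ v → label G π v <? δ G) (vertices (nbrs full w)))
    where
    w : Fin p
    w = π ⟨$⟩ˡ fromℕ< (n∸1<n 1≤p)
    label-w : label G π w ≡ p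
    label-w = begin
      suc (toℕ (π ⟨$⟩ʳ (π ⟨$⟩ˡ fromℕ< (n∸1<n 1≤p))))  ≡⟨ cong (suc ∘ toℕ) (inverseʳ π) ⟩
      suc (toℕ (fromℕ< (n∸1<n 1≤p)))                  ≡⟨ cong suc (toℕ-fromℕ< (n∸1<n 1≤p)) ⟩
      suc (p ∸ 1)                                    ≡⟨ m+[n∸m]≡n 1≤p ⟩
      p                                              ∎
      where open ≡-Reasoning
    w-not-isolated : isIsolated G full w ≡ false
    w-not-isolated with deg G full w | no-isolated w
    ... | suc _ | _ = refl
    δ∸1<deg : δ G ∸ 1 < deg G full w
    δ∸1<deg = ≤-<-trans (∸-monoˡ-≤ 1 (minDeg≤deg (¬isolated⇒core {S = full} refl w-not-isolated))) (n∸1<n (no-isolated w))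
    from-labels : Dec (All (λ v → label G π v < δ G) (vertices (nbrs full w))) → p + δ G ≤ strf G π
    from-labels (yes labels<) = contradiction
      (subst (_≤ δ G ∸ 1) (sym (count≡length-vertices (nbrs full w))) (labels<⇒length≤ π (vertices-unique _) labels<))
      (<⇒≱ δ∸1<deg)
    from-labels (no ¬labels<) with find (¬All⇒Any¬ (λ v → label G π v <? δ G) _ ¬labels<)
    ... | y , y∈ , ¬y<δ = begin
      p + δ G                    ≤⟨ +-mono-≤ (≤-reflexive (sym label-w)) (≮⇒≥ ¬y<δ) ⟩
      label G π w + label G π y  ≤⟨ edge≤strf π (∈-vertices⁻ {P = nbrs full w} y∈) ⟩
      strf G π                   ∎
      where open ≤-Reasoning

  next-true⁻ : ∀ {S u v} → next G S u v ≡ true → core G S v ≡ true × ⁅ u ⁆ v ≡ false × adj G u v ≡ false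
  next-true⁻ = go
    where
    go : ∀ {c e a} → c ∧ not e ∧ not a ≡ true → c ≡ true × e ≡ false × a ≡ false
    go {true} {false} {false} refl = refl , refl , refl

  next⇒∈ : ∀ {S u v} → next G S u v ≡ true → S v ≡ true
  next⇒∈ {S} = core⇒∈ {S = S} ∘ proj₁ ∘ next-true⁻ {S = S}

  next⇒¬adj : ∀ {S u v} → next G S u v ≡ true → adj G u v ≡ false
  next⇒¬adj {S} = proj₂ ∘ proj₂ ∘ next-true⁻ {S = S}

  next-true⁺ : ∀ {S u v} → core G S v ≡ true → ⁅ u ⁆ v ≡ false → adj G u v ≡ false → next G S u v ≡ true
  next-true⁺ cv uv ¬uv rewrite cv | uv | ¬uv = refl

  data Role (S : VSet p) (u x : Fin p) : Set where
    neighbour : nbrs S u x ≡ true → Role S u x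
    centre    : u ≡ x → Role S u x
    isolated  : isIsolated G S x ≡ true → Role S u x
    later     : next G S u x ≡ true → Role S u x

  role : ∀ {S} u {x} → S x ≡ true → Role S u x
  role {S} u {x} Sx with adj G u x in ux | u ≟ x in u≟x | isIsolated G S x in ix
  ... | true  | _            | _     = neighbour (cong₂ _∧_ Sx ux)
  ... | false | yes u≡x      | _     = centre u≡x
  ... | false | no _         | true  = isolated ix
  ... | false | no _         | false = later (next-true⁺ {S = S} (¬isolated⇒core {S = S} Sx ix) (cong does u≟x) ux)

  order : ∀ {S ys} → DSeq G S ys → List (Fin p)
  order (stopIso {S} _)        = vertices S
  order (stopClique {S} _)     = vertices (core G S) ++ vertices (isIsolated G S)
  order (step {S} u _ _ _ _ d) =
    vertices (nbrs S u) ++ order d ++ vertices ⁅ u ⁆ ++ vertices (isIsolated G S)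

  core-split : ∀ S → vertices S ↭ vertices (core G S) ++ vertices (isIsolated G S)
  core-split S = subst (λ I → vertices S ↭ vertices (core G S) ++ I)
    (vertices-cong {P = S ∖ core G S} non-core⊆isolated isolated⊆non-core) (vertices-split (core⇒∈ {S = S}))
    where
    non-core⊆isolated : (S ∖ core G S) ⊆ isIsolated G S
    non-core⊆isolated {v} h = ¬core⇒isolated {S = S} (proj₁ (∧-not-true⁻ {S v} h)) (proj₂ (∧-not-true⁻ {S v} h))
    isolated⊆non-core : isIsolated G S ⊆ (S ∖ core G S)
    isolated⊆non-core {v} iv = ∧-not-true⁺ (isolated⇒∈ {S = S} iv) (∧-false (S v) (cong not iv))

  step-split : ∀ {S u} → core G S u ≡ true →
    vertices S ↭ vertices (nbrs S u) ++ vertices (next G S u) ++ vertices ⁅ u ⁆ ++ vertices (isIsolated G S)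
  step-split {S} {u} cu = begin
    vertices S                               ↭⟨ vertices-split nbrs⊆S ⟩
    Nu ++ vertices R₁                         ↭⟨ ++⁺ˡ Nu (vertices-split next⊆R₁) ⟩
    Nu ++ X ++ vertices R₂                    ↭⟨ ++⁺ˡ Nu (++⁺ˡ X (vertices-split ⁅u⁆⊆R₂)) ⟩
    Nu ++ X ++ vertices ⁅ u ⁆ ++ vertices R₃  ≡⟨ cong (λ I → Nu ++ X ++ vertices ⁅ u ⁆ ++ I) (vertices-cong R₃⊆I I⊆R₃) ⟩
    Nu ++ X ++ vertices ⁅ u ⁆ ++ vertices (isIsolated G S) ∎
    where
    open PermutationReasoning
    Nu = vertices (nbrs S u)
    X  = vertices (next G S u)
    R₁ = S ∖ nbrs S u
    R₂ = R₁ ∖ next G S u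
    R₃ = R₂ ∖ ⁅ u ⁆
    Su : S u ≡ true
    Su = core⇒∈ {S = S} cu
    not-nbr : ∀ {v} → adj G u v ≡ false → nbrs S u v ≡ false
    not-nbr {v} = ∧-false (S v)
    nbrs⊆S : nbrs S u ⊆ S
    nbrs⊆S = proj₁ ∘ ∧-true⁻
    next⊆R₁ : next G S u ⊆ R₁
    next⊆R₁ nv = ∧-not-true⁺ (next⇒∈ {S = S} nv) (not-nbr (next⇒¬adj {S = S} nv))
    ⁅u⁆⊆R₂ : ⁅ u ⁆ ⊆ R₂
    ⁅u⁆⊆R₂ {v} uv with ⁅⁆-sound {u = u} {v} uv
    ... | refl = ∧-not-true⁺ (∧-not-true⁺ Su (not-nbr (irrefl G u))) (¬-not λ nu →
      contradiction (trans (sym (proj₁ (proj₂ (next-true⁻ {S = S} nu)))) (⁅⁆-refl u)) λ ())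
    R₃⊆I : R₃ ⊆ isIsolated G S
    R₃⊆I {v} h = ¬-not λ ¬iv →
      contradiction (trans (sym ¬Xv) (next-true⁺ {S = S} (¬isolated⇒core {S = S} Sv ¬iv) ¬Uv ¬uv)) λ ()
      where
      R₂v = proj₁ (∧-not-true⁻ {R₂ v} h)
      ¬Uv = proj₂ (∧-not-true⁻ {R₂ v} h)
      R₁v = proj₁ (∧-not-true⁻ {R₁ v} R₂v)
      ¬Xv = proj₂ (∧-not-true⁻ {R₁ v} R₂v)
      Sv  = proj₁ (∧-not-true⁻ {S v} R₁v)
      ¬uv : adj G u v ≡ false
      ¬uv = trans (sym (cong (_∧ adj G u v) Sv)) (proj₂ (∧-not-true⁻ {S v} R₁v))
    I⊆R₃ : isIsolated G S ⊆ R₃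
    I⊆R₃ {v} iv = ∧-not-true⁺ (∧-not-true⁺ (∧-not-true⁺ Sv (not-nbr ¬uv)) ¬Xv) ¬Uv
      where
      Sv = isolated⇒∈ {S = S} iv
      v-not-core : core G S v ≢ true
      v-not-core cv = contradiction (trans (sym iv) (core⇒¬isolated {S = S} cv)) λ ()
      ¬uv : adj G u v ≡ false
      ¬uv = ¬-not λ uv → isolated-no-edge {S = S} iv Su (adj-sym uv)
      ¬Xv : next G S u v ≡ false
      ¬Xv = ¬-not (v-not-core ∘ proj₁ ∘ next-true⁻ {S = S})
      ¬Uv : ⁅ u ⁆ v ≡ false
      ¬Uv = ¬-not λ uv → v-not-core (subst (λ w → core G S w ≡ true) (⁅⁆-sound uv) cu)

  order-↭ : ∀ {S ys} (d : DSeq G S ys) → order d ↭ vertices S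
  order-↭ (stopIso _)             = ↭-refl
  order-↭ (stopClique {S} _)      = ↭-sym (core-split S)
  order-↭ (step {S} u _ _ cu _ d) =
    ↭-trans (++⁺ˡ (vertices (nbrs S u)) (++⁺ʳ _ (order-↭ d))) (↭-sym (step-split cu))

  top-budget-∷ : ∀ {m e ys} → e ≤ δ G → PrefNonneg (+ 0) ys →
             PrefNonneg (slack (p + δ G) (p + 1)) (ytil G m e ∷ ys)
  top-budget-∷ {m} {e} {ys} e≤δ ys≥0 = 0≤head , PrefNonneg-mono ys 0≤head ys≥0
    where
    0≤head = 0≤slack+ỹ⇐ (p + δ G) (p + 1) m e (begin
      p + 1 + e          ≡⟨ +-assoc p 1 e ⟩
      p + suc e          ≤⟨ +-monoʳ-≤ p (s≤s e≤δ) ⟩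
      p + suc (δ G)      ≡⟨ +-suc p (δ G) ⟩
      suc (p + δ G)      ≡⟨ +-comm 1 (p + δ G) ⟩
      p + δ G + 1        ≤⟨ +-monoʳ-≤ (p + δ G) (m≤n+m 1 m) ⟩
      p + δ G + (m + 1)  ∎)
      where open ≤-Reasoning

  top-budget : ∀ {ys} → DSeq G full ys → ZNonneg ys → PrefNonneg (slack (p + δ G) (p + 1)) ys
  top-budget (stopIso _)        = top-budget-∷ z≤n
  top-budget (stopClique clq)   = top-budget-∷ (clique-rCore∸1≤minDeg clq)
  top-budget (step _ _ _ _ _ _) = top-budget-∷ ≤-refl

-- Numbering along a δ-sequence

module UpperBound {p : ℕ} (G : Graph p) (lab : Fin p → ℕ)
                  (lab-injective : ∀ {v w} → lab v ≡ lab w → v ≡ w) (N : ℕ) where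

  Occupies : ℕ → List (Fin p) → Set
  Occupies a M = ∀ {P Q v} → M ≡ P ++ Q → v ∈ P → lab v ≤ a + length P

  occupies-∈ : ∀ {a M v} → Occupies a M → v ∈ M → lab v ≤ a + length M
  occupies-∈ {M = M} occ = occ (sym (++-identityʳ M))

  occupies-++ˡ : ∀ {a P Q} → Occupies a (P ++ Q) → Occupies a P
  occupies-++ˡ {Q = Q} occ {P′} {R} P≡ = occ (trans (cong (_++ Q) P≡) (++-assoc P′ R Q))

  occupies-++ʳ : ∀ {a P Q} → Occupies a (P ++ Q) → Occupies (a + length P) Q
  occupies-++ʳ {a} {P} occ {Q′} {R} {v} Q≡ v∈ =
    subst (lab v ≤_) shift-offset (occ (trans (cong (P ++_) Q≡) (sym (++-assoc P Q′ R))) (∈-++⁺ʳ P v∈))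
    where
    shift-offset : a + length (P ++ Q′) ≡ a + length P + length Q′
    shift-offset = trans (cong (_+_ a) (length-++ P)) (sym (+-assoc a _ _))

  -- The part of the δ-sequence starting at 𝒢[S] is numbered in the interval following a, in
  -- the order `order G d`; the neighbours of S outside S have numbers at most a.  The budget
  -- is the z̃-condition for the remaining ỹ_j, shifted by N − (2a + |S| + 1).
  record Slot {S ys} (d : DSeq G S ys) (a : ℕ) : Set where
    field
      occupies : Occupies a (order G d)
      closed   : ∀ {x y} → S x ≡ true → adj G x y ≡ true → S y ≡ true ⊎ lab y ≤ a
      fits     : a + a + length (order G d) ≤ N
      budget   : PrefNonneg (slack N (a + a + length (order G d) + 1)) ys

  EdgesBounded : VSet p → Set
  EdgesBounded S = ∀ {x y} → S x ≡ true → adj G x y ≡ true → lab x + lab y ≤ N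

  InnerEdgesBounded : VSet p → Set
  InnerEdgesBounded S = ∀ {x y} → S x ≡ true → S y ≡ true → adj G x y ≡ true → lab x + lab y ≤ N

  isolated-inner-edges : ∀ {S} → FormIso G S → InnerEdgesBounded S
  isolated-inner-edges {S} (no-core , _) {x} Sx Sy xy =
    ⊥-elim (isolated-no-edge G {S = S} (¬core⇒isolated G {S = S} Sx (no-core x)) Sy xy)

  module Clique {S a} {clq : FormClique G S} (slot : Slot (stopClique {S = S} clq) a) where
    open Slot slot

    Cl = vertices (core G S)
    Il = vertices (isIsolated G S)
    r  = length Cl
    m  = length Il

    core-label : ∀ {v} → core G S v ≡ true → lab v ≤ a + r
    core-label cv = occupies {P = Cl} {Q = Il} refl (∈-vertices⁺ cv)

    1≤r : 1 ≤ r
    1≤r = ≤-trans (s≤s z≤n) (subst (2 ≤_) (count≡length-vertices (core G S)) (proj₂ clq))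

    room : (a + r) + (a + r) ≤ suc N
    room = clique-room a r m N 1≤r (begin
      a + a + (r + m) + 1 + (r ∸ 1)                    ≡⟨ cong₂ (λ l e → a + a + l + 1 + (e ∸ 1)) (length-++ Cl) rCore≡r ⟨
      a + a + length (Cl ++ Il) + 1 + (rCore G S ∸ 1)  ≤⟨ 0≤slack+ỹ⇒ N _ (mIso G S) (rCore G S ∸ 1) (proj₁ budget) ⟩
      N + (mIso G S + 1)                               ≡⟨ cong (λ i → N + (i + 1)) mIso≡m ⟩
      N + (m + 1)                                      ∎)
      where
      open ≤-Reasoning
      rCore≡r = count≡length-vertices (core G S)
      mIso≡m  = count≡length-vertices (isIsolated G S)

    inner-edges-bounded : InnerEdgesBounded S
    inner-edges-bounded {x} {y} Sx Sy xy with isIsolated G S x in ix | isIsolated G S y in iy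
    ... | true  | _     = ⊥-elim (isolated-no-edge G {S = S} ix Sy xy)
    ... | false | true  = ⊥-elim (isolated-no-edge G {S = S} iy Sx (adj-sym G xy))
    ... | false | false = m<1+n⇒m≤n (<-≤-trans
      (distinct-sum< (core-label (¬isolated⇒core G {S = S} Sx ix))
                     (core-label (¬isolated⇒core G {S = S} Sy iy))
                     (adj⇒≢ G xy ∘ lab-injective))
      room)

  module Step {S ys a u nI nC cu du} {d : DSeq G (next G S u) ys}
              (slot : Slot (step {S = S} u nI nC cu du d) a) where
    open Slot slot

    Nu = vertices (nbrs G S u)
    U  = vertices ⁅ u ⁆
    I  = vertices (isIsolated G S)
    n  = length Nu
    o  = length (order G d)
    k  = length U
    m  = length I

    nbr-label : ∀ {v} → nbrs G S u v ≡ true → lab v ≤ a + n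
    nbr-label nv = occupies {P = Nu} {Q = order G d ++ U ++ I} refl (∈-vertices⁺ nv)

    near-label : ∀ {v} → nbrs G S u v ≡ true → lab v ≤ a + n + o + k
    near-label nv = ≤-trans (nbr-label nv) (≤-trans (m≤m+n (a + n) o) (m≤m+n (a + n + o) k))

    centre-label : lab u ≤ a + n + o + k
    centre-label = occupies-++ʳ {P = order G d} {Q = U ++ I} (occupies-++ʳ {P = Nu} occupies)
                     {P = U} {Q = I} refl (∈-vertices⁺ (⁅⁆-refl u))

    1≤k : 1 ≤ k
    1≤k = ∈-length (∈-vertices⁺ {P = ⁅ u ⁆} (⁅⁆-refl u))

    c : ℕ
    c = a + a + length (Nu ++ order G d ++ U ++ I) + 1

    length-order : length (Nu ++ order G d ++ U ++ I) ≡ n + (o + (k + m))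
    length-order = begin
      length (Nu ++ order G d ++ U ++ I)  ≡⟨ length-++ Nu ⟩
      n + length (order G d ++ U ++ I)    ≡⟨ cong (_+_ n) (length-++ (order G d)) ⟩
      n + (o + length (U ++ I))           ≡⟨ cong (λ l → n + (o + l)) (length-++ U) ⟩
      n + (o + (k + m))                   ∎
      where open ≡-Reasoning

    minDeg≡n : minDeg G S ≡ n
    minDeg≡n = trans (sym du) (count≡length-vertices (nbrs G S u))

    mIso≡m : mIso G S ≡ m
    mIso≡m = count≡length-vertices (isIsolated G S)

    c+minDeg≡ : c + minDeg G S ≡ a + n + (a + n + o + k) + (m + 1)
    c+minDeg≡ = begin
      c + minDeg G S                        ≡⟨ cong₂ (λ l e → a + a + l + 1 + e) length-order minDeg≡n ⟩
      a + a + (n + (o + (k + m))) + 1 + n   ≡⟨ step-identity a n o k m ⟨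
      a + n + (a + n + o + k) + (m + 1)     ∎
      where open ≡-Reasoning

    headroom : (a + n) + (a + n + o + k) ≤ N
    headroom = +-cancelʳ-≤ (m + 1) _ _ (begin
      a + n + (a + n + o + k) + (m + 1)  ≡⟨ c+minDeg≡ ⟨
      c + minDeg G S                     ≤⟨ 0≤slack+ỹ⇒ N c (mIso G S) (minDeg G S) (proj₁ budget) ⟩
      N + (mIso G S + 1)                 ≡⟨ cong (λ i → N + (i + 1)) mIso≡m ⟩
      N + (m + 1)                        ∎)
      where open ≤-Reasoning

    transfer : a + n + (a + n) + o + 1 + (mIso G S + 1) ≤ c + minDeg G S
    transfer = begin
      a + n + (a + n) + o + 1 + (mIso G S + 1)  ≡⟨ cong (λ i → a + n + (a + n) + o + 1 + (i + 1)) mIso≡m ⟩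
      a + n + (a + n) + o + 1 + (m + 1)         ≤⟨ +-monoˡ-≤ (m + 1) (a+a+o+1≤a+[a+o+k] (a + n) o k 1≤k) ⟩
      a + n + (a + n + o + k) + (m + 1)         ≡⟨ c+minDeg≡ ⟨
      c + minDeg G S                            ∎
      where open ≤-Reasoning

    closed′ : ∀ {x y} → next G S u x ≡ true → adj G x y ≡ true → next G S u y ≡ true ⊎ lab y ≤ a + n
    closed′ {x} {y} nx xy with closed (next⇒∈ G {S = S} nx) xy
    ... | inj₂ y≤a = inj₂ (≤-trans y≤a (m≤m+n a n))
    ... | inj₁ Sy with role G {S = S} u Sy
    ...   | neighbour ny = inj₂ (nbr-label ny)
    ...   | centre refl  = contradiction (trans (sym (adj-sym G xy)) (next⇒¬adj G {S = S} nx)) λ ()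
    ...   | isolated iy  = ⊥-elim (isolated-no-edge G {S = S} iy (next⇒∈ G {S = S} nx) (adj-sym G xy))
    ...   | later ny     = inj₁ ny

    descend : Slot d (a + n)
    descend = record
      { occupies = occupies-++ˡ {Q = U ++ I} (occupies-++ʳ {P = Nu} occupies)
      ; closed   = closed′
      ; fits     = ≤-trans (a+a+o≤a+[a+o+k] (a + n) o k) headroom
      ; budget   = PrefNonneg-mono ys
                     (slack+ỹ≤slack N c (a + n + (a + n) + o + 1) (mIso G S) (minDeg G S) transfer)
                     (proj₂ budget)
      }

    nbr-edge : ∀ {v w} → nbrs G S u v ≡ true → lab w ≤ a + n + o + k → lab v + lab w ≤ N
    nbr-edge nv w≤ = ≤-trans (+-mono-≤ (nbr-label nv) w≤) headroom

    inner-edges-bounded : EdgesBounded (next G S u) → InnerEdgesBounded S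
    inner-edges-bounded later-bounded {x} {y} Sx Sy xy with role G {S = S} u Sx | role G {S = S} u Sy
    ... | later nx     | _            = later-bounded nx xy
    ... | _            | later ny     = subst (_≤ N) (+-comm (lab y) (lab x)) (later-bounded ny (adj-sym G xy))
    ... | isolated ix  | _            = ⊥-elim (isolated-no-edge G {S = S} ix Sy xy)
    ... | _            | isolated iy  = ⊥-elim (isolated-no-edge G {S = S} iy Sx (adj-sym G xy))
    ... | neighbour nx | neighbour ny = nbr-edge nx (near-label ny)
    ... | neighbour nx | centre refl  = nbr-edge nx centre-label
    ... | centre refl  | neighbour ny = subst (_≤ N) (+-comm (lab y) (lab x)) (nbr-edge ny centre-label)
    ... | centre refl  | centre refl  = contradiction refl (adj⇒≢ G xy)

  edges-bounded       : ∀ {S ys a} (d : DSeq G S ys) → Slot d a → EdgesBounded S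
  inner-edges-bounded : ∀ {S ys a} (d : DSeq G S ys) → Slot d a → InnerEdgesBounded S

  edges-bounded {a = a} d slot {x} {y} Sx xy with Slot.closed slot Sx xy
  ... | inj₁ Sy  = inner-edges-bounded d slot Sx Sy xy
  ... | inj₂ y≤a = begin
    lab x + lab y                   ≤⟨ +-mono-≤ x≤ y≤a ⟩
    a + length (order G d) + a      ≡⟨ +-comm (a + length (order G d)) a ⟩
    a + (a + length (order G d))    ≡⟨ +-assoc a a _ ⟨
    a + a + length (order G d)      ≤⟨ Slot.fits slot ⟩
    N                               ∎
    where
    open ≤-Reasoning
    x≤ = occupies-∈ (Slot.occupies slot) (∈-resp-↭ (↭-sym (order-↭ G d)) (∈-vertices⁺ Sx))

  inner-edges-bounded (stopIso iso)        _    = isolated-inner-edges iso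
  inner-edges-bounded (stopClique _)       slot = Clique.inner-edges-bounded slot
  inner-edges-bounded (step _ _ _ _ _ d)   slot =
    Step.inner-edges-bounded slot (edges-bounded d (Step.descend slot))

mainTheorem1 : (p : ℕ) (G : Graph p) →
    (∀ v → 1 ≤ deg G full v) →
    1 ≤ δ G → δ G + 2 ≤ p →
    Σ (List ℤ) (λ ys → DSeq G full ys × ZNonneg ys) →
    IsStr G (p + δ G)
mainTheorem1 p G no-isolated _ δ+2≤p (ys , d , z̃≥0) = (π , ≤-antisym upper (lower π)) , lower
  where
  1≤p : 1 ≤ p
  1≤p = ≤-trans (s≤s z≤n) (≤-trans (m≤n+m 2 (δ G)) δ+2≤p)
  lower : ∀ π → p + δ G ≤ strf G π
  lower = p+δ≤strf G 1≤p no-isolated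
  open Numbering (subst (order G d ↭_) vertices-full (order-↭ G d))
  π = numbering
  open UpperBound G (label G π) (⟨$⟩ʳ-injective π ∘ toℕ-injective ∘ suc-injective) (p + δ G)
  top-slot : Slot d 0
  top-slot = record
    { occupies = numbering-prefix
    ; closed   = λ _ _ → inj₁ refl
    ; fits     = subst (_≤ p + δ G) (sym length≡p) (m≤m+n p (δ G))
    ; budget   = subst (λ l → PrefNonneg (slack (p + δ G) (l + 1)) ys) (sym length≡p) (top-budget G d z̃≥0)
    }
  upper : strf G π ≤ p + δ G
  upper = strf-lub G π (edges-bounded d top-slot refl)
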